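{- Let $d\ge2$ and integers $u_1,\dots,u_d\ge 2$ be fixed, let $\mathscr{P}=\prod_{j=1}^d\{1,2,\dots,u_j\}$, and let $u=\prod_{j=1}^d u_j$. Let $\mathbf{p}_1,\dots,\mathbf{p}_n$ be independent points uniformly distributed on $\mathscr{P}$, and for $1\le k\le d$ let $M^{[c]}_{d,k}(n)$ be the number of $k$-dominant skyline points of $\{\mathbf{p}_1,\dots,\mathbf{p}_n\}$ (counted with multiplicity over indices $i=1,\dots,n$). Then for every $1\le k\le d$, \[ \frac{\mathbb{E}[M^{[c]}_{d,k}(n)]}{n}\to \frac1u\qquad (n\to\infty). \]
   Context: For points $\mathbf{p}=(p_1,\dots,p_d)$, $\mathbf{q}=(q_1,\dots,q_d)$, $\mathbf{p}$ $k$-dominates $\mathbf{q}$ if there is a set $S$ of $k$ coordinates such that $p_j\le q_j$ for all $j\in S$ and $p_j<q_j$ for at least one $j\in S$. A point $\mathbf{p}_i$ of the sample is a $k$-dominant skyline point if no $\mathbf{p}_\ell$, $\ell\ne i$, $k$-dominates it. -}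

module Defs where

open import Data.Nat using (ℕ; zero; suc; _≤_; _<_; _≤?_; _<?_; _*_)
open import Data.Nat.Properties using (_≟_)
open import Data.Fin using (Fin; zero; suc)
open import Data.Fin.Properties as FinP using (all?; any?)
open import Data.Fin.Subset using (Subset; _∈_; ∣_∣)
open import Data.Fin.Subset.Properties using (_∈?_; anySubset?)
open import Data.Vec.Functional using () renaming (_∷_ to _∷ᶠ_)
open import Data.List using (List; []; _∷_; map; concatMap; upTo; length; filter; allFin)
open import Data.Nat.ListAction using (sum)
open import Data.Product using (Σ; ∃; _×_; _,_)
open import Data.Integer using (+_)
open import Data.Rational using (ℚ; 0ℚ; _/_)
open import Relation.Nullary using (¬_; Dec)
open import Relation.Nullary.Decidable using (_×-dec_; _→-dec_; ¬?)
open import Relation.Binary.PropositionalEquality using (_≡_; _≢_)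
open import Function using (_∘_)

Point : ℕ → Set
Point d = Fin d → ℕ

KDominates : {d : ℕ} → ℕ → Point d → Point d → Set
KDominates {d} k p q =
  Σ (Subset d) λ S → (∣ S ∣ ≡ k) × ((∀ j → j ∈ S → p j ≤ q j) × (∃ λ j → j ∈ S × p j < q j))

kDominates? : {d : ℕ} (k : ℕ) (p q : Point d) → Dec (KDominates k p q)
kDominates? {d} k p q = anySubset? λ S →
  (∣ S ∣ ≟ k) ×-dec (all? (λ j → (j ∈? S) →-dec (p j ≤? q j))
                    ×-dec any? (λ j → (j ∈? S) ×-dec (p j <? q j)))

IsKSkyline : {d n : ℕ} → ℕ → (Fin n → Point d) → Fin n → Set
IsKSkyline k s i = ∀ ℓ → ℓ ≢ i → ¬ KDominates k (s ℓ) (s i)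

isKSkyline? : {d n : ℕ} (k : ℕ) (s : Fin n → Point d) (i : Fin n) → Dec (IsKSkyline k s i)
isKSkyline? k s i = all? λ ℓ → ¬? (ℓ FinP.≟ i) →-dec ¬? (kDominates? k (s ℓ) (s i))

skylineCount : {d n : ℕ} → ℕ → (Fin n → Point d) → ℕ
skylineCount {n = n} k s = length (filter (isKSkyline? k s) (allFin n))

allPoints : (d : ℕ) → (Fin d → ℕ) → List (Point d)
allPoints zero u = (λ ()) ∷ []
allPoints (suc d) u =
  concatMap (λ a → map (λ p → a ∷ᶠ p) (allPoints d (u ∘ suc))) (map suc (upTo (u zero)))

tuples : {A : Set} → List A → (n : ℕ) → List (Fin n → A)
tuples L zero = (λ ()) ∷ []
tuples L (suc n) = concatMap (λ a → map (λ t → a ∷ᶠ t) (tuples L n)) L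

-- a / b as a rational, with the convention a / 0 = 0
frac : ℕ → ℕ → ℚ
frac a zero = 0ℚ
frac a (suc b) = (+ a) / suc b

prodF : (d : ℕ) → (Fin d → ℕ) → ℕ
prodF zero u = 1
prodF (suc d) u = u zero * prodF d (u ∘ suc)

-- E[M^{[c]}_{d,k}(n)] for n i.i.d. uniform points on ∏_j {1,…,u_j}:
-- average of the skyline count over all (equally likely) samples.
expectedSkyline : (d : ℕ) → (Fin d → ℕ) → (k n : ℕ) → ℚ
expectedSkyline d u k n =
  frac (sum (map (skylineCount k) samples)) (length samples)
  where
  samples : List (Fin n → Point d)
  samples = tuples (allPoints d u) n

module Submission where

-- The origin o = (1,…,1) k-dominates every other grid point (choose a coordinate where the
-- point exceeds 1 and any k coordinates containing it), while nothing k-dominates a copy of o.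
-- Hence for every sample s of size n
--     #{i : s_i = o}  ≤  #k-skyline(s)  ≤  #{i : s_i = o} + n · [o ∉ s].
-- Averaging over the uⁿ equally likely samples, the left side has mean n/u (linearity of
-- expectation) and [o ∉ s] has mean ((u-1)/u)ⁿ (independence of the coordinates of s), so
--     1/u  ≤  E[M]/n  ≤  1/u + ((u-1)/u)ⁿ,
-- and the error term decays geometrically by Bernoulli's inequality.

module Sums where

  open import Defs using (tuples)

  open import Data.Bool.Base using (true; false)
  open import Data.Empty using (⊥-elim)
  open import Data.Nat using (ℕ; zero; suc; _+_; _*_; _^_; _≤_; z≤n)
  open import Data.Nat.Properties
  open import Data.Nat.ListAction using (sum)
  open import Data.Nat.ListAction.Properties using (sum-++)
  open import Data.Nat.Tactic.RingSolver using (solve-∀)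
  open import Data.Fin using (Fin; zero; suc)
  open import Data.List using (List; []; _∷_; map; concatMap; length; _++_; filter; tabulate)
  open import Data.List.Properties using (map-++; map-∘)
  open import Data.List.Relation.Unary.All using (All; []; _∷_)
  import Data.List.Relation.Unary.All as All
  open import Data.List.Relation.Unary.All.Properties using (++⁺; map⁺)
  open import Data.Vec.Functional using (foldr) renaming (_∷_ to _∷ᶠ_)
  open import Relation.Nullary using (Dec; yes; no; _because_; ¬?; _×-dec_)
  open import Relation.Unary using (Decidable)
  open import Relation.Binary.PropositionalEquality
  open import Function using (_∘_)

  private variable
    A : Set
    n : ℕ

  𝟙 : Dec A → ℕ
  𝟙 (true because _) = 1
  𝟙 (false because _) = 0

  𝟙-mono : {P Q : Set} → (P → Q) → (p? : Dec P) (q? : Dec Q) → 𝟙 p? ≤ 𝟙 q?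
  𝟙-mono P⇒Q (yes p) (yes q) = ≤-refl
  𝟙-mono P⇒Q (yes p) (no ¬q) = ⊥-elim (¬q (P⇒Q p))
  𝟙-mono P⇒Q (no ¬p) q? = z≤n

  𝟙-cong : {P Q : Set} → (P → Q) → (Q → P) → (p? : Dec P) (q? : Dec Q) → 𝟙 p? ≡ 𝟙 q?
  𝟙-cong P⇒Q Q⇒P p? q? = ≤-antisym (𝟙-mono P⇒Q p? q?) (𝟙-mono Q⇒P q? p?)

  𝟙-× : {P Q : Set} (p? : Dec P) (q? : Dec Q) → 𝟙 (p? ×-dec q?) ≡ 𝟙 p? * 𝟙 q?
  𝟙-× (yes p) (yes q) = refl
  𝟙-× (yes p) (no ¬q) = refl
  𝟙-× (no ¬p) q? = refl

  𝟙-¬ : (p? : Dec A) → 𝟙 p? + 𝟙 (¬? p?) ≡ 1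
  𝟙-¬ (yes p) = refl
  𝟙-¬ (no ¬p) = refl

  Σᶠ Πᶠ : (Fin n → ℕ) → ℕ
  Σᶠ = foldr _+_ 0
  Πᶠ = foldr _*_ 1

  Σᶠ-mono : {f g : Fin n → ℕ} → (∀ i → f i ≤ g i) → Σᶠ f ≤ Σᶠ g
  Σᶠ-mono {zero} f≤g = z≤n
  Σᶠ-mono {suc n} f≤g = +-mono-≤ (f≤g zero) (Σᶠ-mono (f≤g ∘ suc))

  Πᶠ-𝟙 : {P : Fin n → Set} (P? : ∀ i → Dec (P i)) → (∀ i → P i) → Πᶠ (𝟙 ∘ P?) ≡ 1
  Πᶠ-𝟙 {zero} P? all = refl
  Πᶠ-𝟙 {suc n} P? all with P? zero
  ... | yes _ = trans (+-identityʳ _) (Πᶠ-𝟙 (P? ∘ suc) (all ∘ suc))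
  ... | no ¬P = ⊥-elim (¬P (all zero))

  length-filter-tabulate : {P : A → Set} (P? : Decidable P) (f : Fin n → A) →
    length (filter P? (tabulate f)) ≡ Σᶠ (λ i → 𝟙 (P? (f i)))
  length-filter-tabulate {n = zero} P? f = refl
  length-filter-tabulate {n = suc n} P? f with P? (f zero)
  ... | true because _ = cong suc (length-filter-tabulate P? (f ∘ suc))
  ... | false because _ = length-filter-tabulate P? (f ∘ suc)

  sumL : (A → ℕ) → List A → ℕ
  sumL f xs = sum (map f xs)

  sumL-++ : (f : A → ℕ) (xs ys : List A) → sumL f (xs ++ ys) ≡ sumL f xs + sumL f ys
  sumL-++ f xs ys = trans (cong sum (map-++ f xs ys)) (sum-++ (map f xs) (map f ys))

  sumL-map : {B : Set} (f : B → ℕ) (g : A → B) (xs : List A) → sumL f (map g xs) ≡ sumL (f ∘ g) xs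
  sumL-map f g xs = cong sum (sym (map-∘ xs))

  sumL-cong : {f g : A → ℕ} → (∀ x → f x ≡ g x) → (xs : List A) → sumL f xs ≡ sumL g xs
  sumL-cong f≡g [] = refl
  sumL-cong f≡g (x ∷ xs) = cong₂ _+_ (f≡g x) (sumL-cong f≡g xs)

  sumL-+ : (f g : A → ℕ) (xs : List A) → sumL (λ x → f x + g x) xs ≡ sumL f xs + sumL g xs
  sumL-+ f g [] = refl
  sumL-+ f g (x ∷ xs) = trans (cong (f x + g x +_) (sumL-+ f g xs)) (swap (f x) (g x) _ _)
    where
    swap : ∀ a b c d → a + b + (c + d) ≡ a + c + (b + d)
    swap = solve-∀

  sumL-*ˡ : (c : ℕ) (f : A → ℕ) (xs : List A) → sumL (λ x → c * f x) xs ≡ c * sumL f xs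
  sumL-*ˡ c f [] = sym (*-zeroʳ c)
  sumL-*ˡ c f (x ∷ xs) = trans (cong (c * f x +_) (sumL-*ˡ c f xs)) (sym (*-distribˡ-+ c (f x) _))

  sumL-mono : {P : A → Set} {f g : A → ℕ} → (∀ x → P x → f x ≤ g x) →
    {xs : List A} → All P xs → sumL f xs ≤ sumL g xs
  sumL-mono f≤g [] = z≤n
  sumL-mono f≤g (px ∷ pxs) = +-mono-≤ (f≤g _ px) (sumL-mono f≤g pxs)

  length≡sumL : (xs : List A) → length xs ≡ sumL (λ _ → 1) xs
  length≡sumL [] = refl
  length≡sumL (x ∷ xs) = cong suc (length≡sumL xs)

  -- The list of all vectors whose head is taken from xs and whose tail from ys;
  -- both the grid allPoints and the sample space tuples are iterated products of this kind.
  _⊗_ : List A → List (Fin n → A) → List (Fin (suc n) → A)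
  xs ⊗ ys = concatMap (λ a → map (a ∷ᶠ_) ys) xs

  All-⊗ : {P : A → Set} {Q : (Fin n → A) → Set} {R : (Fin (suc n) → A) → Set} →
    (∀ a t → P a → Q t → R (a ∷ᶠ t)) →
    {xs : List A} {ys : List (Fin n → A)} → All P xs → All Q ys → All R (xs ⊗ ys)
  All-⊗ r [] qs = []
  All-⊗ r (pa ∷ ps) qs = ++⁺ (map⁺ (All.map (λ {t} → r _ t pa) qs)) (All-⊗ r ps qs)

  sum-⊗ : {A : Set} {n : ℕ} (f : A → ℕ) (g : (Fin n → A) → ℕ) (xs : List A) (ys : List (Fin n → A)) →
    sumL (λ t → f (t zero) * g (t ∘ suc)) (xs ⊗ ys) ≡ sumL f xs * sumL g ys
  sum-⊗ f g [] ys = refl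
  sum-⊗ {A} {n} f g (a ∷ xs) ys = begin
    sumL h (map (a ∷ᶠ_) ys ++ (xs ⊗ ys))      ≡⟨ sumL-++ h (map (a ∷ᶠ_) ys) (xs ⊗ ys) ⟩
    sumL h (map (a ∷ᶠ_) ys) + sumL h (xs ⊗ ys) ≡⟨ cong₂ _+_ (sumL-map h (a ∷ᶠ_) ys) (sum-⊗ f g xs ys) ⟩
    sumL (λ t → f a * g t) ys + F * G          ≡⟨ cong (_+ F * G) (sumL-*ˡ (f a) g ys) ⟩
    f a * G + F * G                            ≡⟨ sym (*-distribʳ-+ G (f a) F) ⟩
    (f a + F) * G                              ∎
    where
    open ≡-Reasoning
    h : (Fin (suc n) → A) → ℕ
    h t = f (t zero) * g (t ∘ suc)
    F G : ℕ
    F = sumL f xs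
    G = sumL g ys

  length-⊗ : (xs : List A) (ys : List (Fin n → A)) → length (xs ⊗ ys) ≡ length xs * length ys
  length-⊗ xs ys = begin
    length (xs ⊗ ys)                          ≡⟨ length≡sumL (xs ⊗ ys) ⟩
    sumL (λ _ → 1) (xs ⊗ ys)                  ≡⟨ sum-⊗ (λ _ → 1) (λ _ → 1) xs ys ⟩
    sumL (λ _ → 1) xs * sumL (λ _ → 1) ys     ≡⟨ sym (cong₂ _*_ (length≡sumL xs) (length≡sumL ys)) ⟩
    length xs * length ys                     ∎
    where open ≡-Reasoning

  sum-⊗-+ : (f : A → ℕ) (g : (Fin n → A) → ℕ) (xs : List A) (ys : List (Fin n → A)) →
    sumL (λ t → f (t zero) + g (t ∘ suc)) (xs ⊗ ys) ≡ sumL f xs * length ys + length xs * sumL g ys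
  sum-⊗-+ f g xs ys = begin
    sumL (λ t → f (t zero) + g (t ∘ suc)) (xs ⊗ ys)
      ≡⟨ sumL-cong (λ t → cong₂ _+_ (sym (*-identityʳ (f (t zero)))) (sym (*-identityˡ (g (t ∘ suc)))))
                   (xs ⊗ ys) ⟩
    sumL (λ t → f (t zero) * 1 + 1 * g (t ∘ suc)) (xs ⊗ ys)
      ≡⟨ sumL-+ (λ t → f (t zero) * 1) (λ t → 1 * g (t ∘ suc)) (xs ⊗ ys) ⟩
    sumL (λ t → f (t zero) * 1) (xs ⊗ ys) + sumL (λ t → 1 * g (t ∘ suc)) (xs ⊗ ys)
      ≡⟨ cong₂ _+_ (sum-⊗ f (λ _ → 1) xs ys) (sum-⊗ (λ _ → 1) g xs ys) ⟩
    sumL f xs * sumL (λ _ → 1) ys + sumL (λ _ → 1) xs * sumL g ys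
      ≡⟨ cong₂ (λ a b → sumL f xs * a + b * sumL g ys) (sym (length≡sumL ys)) (sym (length≡sumL xs)) ⟩
    sumL f xs * length ys + length xs * sumL g ys ∎
    where open ≡-Reasoning

  tuples-length : (L : List A) (n : ℕ) → length (tuples L n) ≡ length L ^ n
  tuples-length L zero = refl
  tuples-length L (suc n) = trans (length-⊗ L (tuples L n)) (cong (length L *_) (tuples-length L n))

  sum-tuples-Πᶠ : (g : A → ℕ) (L : List A) (n : ℕ) →
    sumL (λ s → Πᶠ (g ∘ s)) (tuples L n) ≡ sumL g L ^ n
  sum-tuples-Πᶠ g L zero = refl
  sum-tuples-Πᶠ g L (suc n) =
    trans (sum-⊗ g (λ t → Πᶠ (g ∘ t)) L (tuples L n)) (cong (sumL g L *_) (sum-tuples-Πᶠ g L n))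

  sum-tuples-Σᶠ : {A : Set} (f : A → ℕ) (L : List A) (n : ℕ) →
    length L * sumL (λ s → Σᶠ (f ∘ s)) (tuples L n) ≡ n * (length L ^ n * sumL f L)
  sum-tuples-Σᶠ f L zero = *-zeroʳ (length L)
  sum-tuples-Σᶠ {A} f L (suc n) = begin
    U * sumL S (L ⊗ tuples L n)                    ≡⟨ cong (U *_) (sum-⊗-+ f S L (tuples L n)) ⟩
    U * (F * length (tuples L n) + U * sumL S (tuples L n))
      ≡⟨ cong₂ (λ a b → U * (F * a + b)) (tuples-length L n) (sum-tuples-Σᶠ f L n) ⟩
    U * (F * U ^ n + n * (U ^ n * F))              ≡⟨ regroup U F (U ^ n) n ⟩
    suc n * (U * U ^ n * F)                        ∎
    where
    open ≡-Reasoning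
    U F : ℕ
    U = length L
    F = sumL f L
    S : ∀ {m} → (Fin m → A) → ℕ
    S s = Σᶠ (f ∘ s)
    regroup : ∀ U F P n → U * (F * P + n * (P * F)) ≡ suc n * (U * P * F)
    regroup = solve-∀

module Skyline where

  open import Defs
  open Sums
  open import Data.Empty using (⊥-elim)
  open import Data.Nat using (ℕ; zero; suc; _+_; _*_; _≤_; _<_; s≤s)
  open import Data.Nat.Properties
  open import Data.Fin using (Fin; zero; suc)
  open import Data.Fin.Properties using (all?; any?; ¬∀⟶∃¬)
  open import Data.Fin.Subset using (Subset; _∈_; ∣_∣; ⊥; ⁅_⁆; inside)
  open import Data.Fin.Subset.Properties using (∣⊥∣≡0; ∣⁅x⁆∣≡1; x∈⁅x⁆)
  open import Data.Vec using (_∷_; here; there)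
  open import Data.List using (allFin; length)
  open import Data.List.Properties using (length-filter; length-tabulate)
  open import Data.Product using (Σ; _×_; _,_)
  open import Relation.Nullary using (¬_; Dec; yes; no; ¬?)
  open import Function using (_∘_; id)
  open import Relation.Binary.PropositionalEquality

  private variable
    d : ℕ

  subsetOfSize : ∀ k → k ≤ d → Σ (Subset d) λ S → ∣ S ∣ ≡ k
  subsetOfSize {d} zero _ = ⊥ , ∣⊥∣≡0 d
  subsetOfSize (suc k) (s≤s k≤d) = let S , ∣S∣≡k = subsetOfSize k k≤d in inside ∷ S , cong suc ∣S∣≡k

  subsetContaining : ∀ k (j : Fin d) → suc k ≤ d → Σ (Subset d) λ S → ∣ S ∣ ≡ suc k × j ∈ S
  subsetContaining zero j _ = ⁅ j ⁆ , ∣⁅x⁆∣≡1 j , x∈⁅x⁆ j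
  subsetContaining (suc k) zero (s≤s k<d) =
    let S , ∣S∣≡k = subsetOfSize (suc k) k<d in inside ∷ S , cong suc ∣S∣≡k , here
  subsetContaining (suc k) (suc j) (s≤s k<d) =
    let S , ∣S∣≡k , j∈S = subsetContaining k j k<d in inside ∷ S , cong suc ∣S∣≡k , there j∈S

  IsOrigin : Point d → Set
  IsOrigin p = ∀ j → p j ≡ 1

  origin? : (p : Point d) → Dec (IsOrigin p)
  origin? p = all? (λ j → p j ≟ 1)

  Positive : Point d → Set
  Positive p = ∀ j → 1 ≤ p j

  -- The origin k-dominates every other positive point, for every 1 ≤ k ≤ d:
  -- pick a coordinate j where q differs from 1 and any k-set containing j.
  origin-dominates : ∀ {k} {p q : Point d} → 1 ≤ k → k ≤ d →
    IsOrigin p → Positive q → ¬ IsOrigin q → KDominates k p q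
  origin-dominates {d} {suc k} {p} {q} (s≤s _) k≤d p-origin q-pos q-not-origin
    with ¬∀⟶∃¬ d (λ i → q i ≡ 1) (λ i → q i ≟ 1) q-not-origin
  ... | j , qj≢1 with subsetContaining k j k≤d
  ... | S , ∣S∣≡k , j∈S = S , ∣S∣≡k , (λ i _ → p≤q i) , j , j∈S , p<q
    where
    p≤q : ∀ i → p i ≤ q i
    p≤q i = subst (_≤ q i) (sym (p-origin i)) (q-pos i)
    p<q : p j < q j
    p<q = subst (_< q j) (sym (p-origin j)) (≤∧≢⇒< (q-pos j) (λ 1≡qj → qj≢1 (sym 1≡qj)))

  ind nonInd : Point d → ℕ
  ind p = 𝟙 (origin? p)
  nonInd p = 𝟙 (¬? (origin? p))

  originCount noOrigin : {n : ℕ} → (Fin n → Point d) → ℕ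
  originCount s = Σᶠ (ind ∘ s)
  noOrigin s = Πᶠ (nonInd ∘ s)

  skylineCount-Σᶠ : ∀ {n} k (s : Fin n → Point d) → skylineCount k s ≡ Σᶠ (λ i → 𝟙 (isKSkyline? k s i))
  skylineCount-Σᶠ k s = length-filter-tabulate (isKSkyline? k s) id

  PositiveSample : {n : ℕ} → (Fin n → Point d) → Set
  PositiveSample s = ∀ i → Positive (s i)

  module _ {n k : ℕ} {s : Fin n → Point d} (s-pos : PositiveSample s) where

    -- Nothing lies strictly below 1 in a coordinate, so a copy of the origin is
    -- never k-dominated: it is always a k-dominant skyline point.
    origin-isSkyline : ∀ {i} → IsOrigin (s i) → IsKSkyline k s i
    origin-isSkyline {i} i-origin ℓ _ (_ , _ , _ , j , _ , sℓj<sij) =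
      <⇒≱ (subst (s ℓ j <_) (i-origin j) sℓj<sij) (s-pos ℓ j)

    skyline-isOrigin : 1 ≤ k → k ≤ d → ∀ {ℓ i} → IsOrigin (s ℓ) → IsKSkyline k s i → IsOrigin (s i)
    skyline-isOrigin 1≤k k≤d {ℓ} {i} ℓ-origin i-skyline with origin? (s i)
    ... | yes i-origin = i-origin
    ... | no i-not-origin =
      ⊥-elim (i-skyline ℓ ℓ≢i (origin-dominates 1≤k k≤d ℓ-origin (s-pos i) i-not-origin))
      where
      ℓ≢i : ℓ ≢ i
      ℓ≢i refl = i-not-origin ℓ-origin

    originCount≤skylineCount : originCount s ≤ skylineCount k s
    originCount≤skylineCount = begin
      originCount s
        ≤⟨ Σᶠ-mono (λ i → 𝟙-mono origin-isSkyline (origin? (s i)) (isKSkyline? k s i)) ⟩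
      Σᶠ (λ i → 𝟙 (isKSkyline? k s i))       ≡⟨ skylineCount-Σᶠ k s ⟨
      skylineCount k s                       ∎
      where open ≤-Reasoning

    -- If the origin occurs, the skyline consists exactly of its copies; otherwise
    -- the skyline has at most n points.
    skylineCount≤ : 1 ≤ k → k ≤ d → skylineCount k s ≤ originCount s + n * noOrigin s
    skylineCount≤ 1≤k k≤d with any? (λ ℓ → origin? (s ℓ))
    ... | yes (ℓ , ℓ-origin) = begin
      skylineCount k s                       ≡⟨ skylineCount-Σᶠ k s ⟩
      Σᶠ (λ i → 𝟙 (isKSkyline? k s i))
        ≤⟨ Σᶠ-mono (λ i → 𝟙-mono (skyline-isOrigin 1≤k k≤d ℓ-origin) (isKSkyline? k s i) (origin? (s i))) ⟩
      originCount s                          ≤⟨ m≤m+n (originCount s) _ ⟩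
      originCount s + n * noOrigin s         ∎
      where open ≤-Reasoning
    ... | no no-origin = begin
      skylineCount k s                       ≤⟨ length-filter (isKSkyline? k s) (allFin n) ⟩
      length (allFin n)                      ≡⟨ length-tabulate id ⟩
      n                                      ≡⟨ *-identityʳ n ⟨
      n * 1
        ≡⟨ cong (n *_) (Πᶠ-𝟙 (λ i → ¬? (origin? (s i))) (λ i i-origin → no-origin (i , i-origin))) ⟨
      n * noOrigin s                         ≤⟨ m≤n+m _ (originCount s) ⟩
      originCount s + n * noOrigin s         ∎
      where open ≤-Reasoning

module Grid where

  open import Defs
  open Sums
  open Skyline
  open import Data.Nat using (ℕ; zero; suc; _*_; _≤_; z≤n; s≤s)
  open import Data.Nat.Properties using (_≟_)
  open import Data.Fin using (zero; suc)
  open import Data.List using (List; map; length; upTo; applyUpTo)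
  open import Data.List.Properties using (length-map; length-upTo)
  open import Data.List.Relation.Unary.All using (All; []; _∷_)
  open import Data.List.Relation.Unary.All.Properties using (map⁺; applyUpTo⁺₂)
  open import Data.Product using (_×_; _,_)
  open import Data.Vec.Functional using () renaming (_∷_ to _∷ᶠ_)
  open import Relation.Nullary using (_×-dec_)
  open import Relation.Binary.PropositionalEquality
  open import Function using (_∘_; id)

  -- The coordinate range {1,…,m}; allPoints (suc d) u is range (u 0) ⊗ allPoints d (u ∘ suc).
  range : ℕ → List ℕ
  range m = map suc (upTo m)

  count-1-in-range : ∀ m → 1 ≤ m → sumL (λ a → 𝟙 (a ≟ 1)) (range m) ≡ 1
  count-1-in-range (suc w) _ = cong suc (no-1-beyond id w)
    where
    no-1-beyond : ∀ (g : ℕ → ℕ) w → sumL (λ a → 𝟙 (a ≟ 1)) (map suc (applyUpTo (suc ∘ g) w)) ≡ 0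
    no-1-beyond g zero = refl
    no-1-beyond g (suc w) = no-1-beyond (g ∘ suc) w

  ind-split : ∀ {d} (p : Point (suc d)) → ind p ≡ 𝟙 (p zero ≟ 1) * ind (p ∘ suc)
  ind-split p = trans (𝟙-cong split join (origin? p) ((p zero ≟ 1) ×-dec origin? (p ∘ suc)))
                      (𝟙-× (p zero ≟ 1) (origin? (p ∘ suc)))
    where
    split : IsOrigin p → p zero ≡ 1 × IsOrigin (p ∘ suc)
    split p-origin = p-origin zero , p-origin ∘ suc
    join : p zero ≡ 1 × IsOrigin (p ∘ suc) → IsOrigin p
    join (head≡1 , tail-origin) zero = head≡1
    join (head≡1 , tail-origin) (suc j) = tail-origin j

  allPoints-length : ∀ d u → length (allPoints d u) ≡ prodF d u
  allPoints-length zero u = refl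
  allPoints-length (suc d) u = trans (length-⊗ (range (u zero)) (allPoints d (u ∘ suc)))
    (cong₂ _*_ (trans (length-map suc (upTo (u zero))) (length-upTo (u zero))) (allPoints-length d (u ∘ suc)))

  allPoints-positive : ∀ d u → All Positive (allPoints d u)
  allPoints-positive zero u = (λ ()) ∷ []
  allPoints-positive (suc d) u =
    All-⊗ cons-positive (map⁺ (applyUpTo⁺₂ id (u zero) (λ _ → s≤s z≤n))) (allPoints-positive d (u ∘ suc))
    where
    cons-positive : ∀ a (p : Point d) → 1 ≤ a → Positive p → Positive (a ∷ᶠ p)
    cons-positive a p 1≤a p-pos zero = 1≤a
    cons-positive a p 1≤a p-pos (suc j) = p-pos j

  allPoints-one-origin : ∀ d u → (∀ j → 1 ≤ u j) → sumL ind (allPoints d u) ≡ 1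
  allPoints-one-origin zero u _ = refl
  allPoints-one-origin (suc d) u u≥1 = begin
    sumL ind (range (u zero) ⊗ P)
      ≡⟨ sumL-cong ind-split (range (u zero) ⊗ P) ⟩
    sumL (λ p → 𝟙 (p zero ≟ 1) * ind (p ∘ suc)) (range (u zero) ⊗ P)
      ≡⟨ sum-⊗ (λ a → 𝟙 (a ≟ 1)) ind (range (u zero)) P ⟩
    sumL (λ a → 𝟙 (a ≟ 1)) (range (u zero)) * sumL ind P
      ≡⟨ cong₂ _*_ (count-1-in-range (u zero) (u≥1 zero)) (allPoints-one-origin d (u ∘ suc) (u≥1 ∘ suc)) ⟩
    1 ∎
    where
    open ≡-Reasoning
    P : List (Point d)
    P = allPoints d (u ∘ suc)

module Totals where

  open import Defs
  open Sums
  open Skyline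
  open import Data.Nat using (ℕ; zero; suc; _+_; _*_; _^_; _≤_)
  open import Data.Nat.Properties
  open import Data.Fin using (Fin; zero; suc)
  open import Data.List using (List; length)
  open import Data.List.Relation.Unary.All using (All; []; _∷_)
  open import Data.Vec.Functional using () renaming (_∷_ to _∷ᶠ_)
  open import Relation.Binary.PropositionalEquality

  module SampleSpace {d : ℕ} (L : List (Point d)) (L-pos : All Positive L) (one-origin : sumL ind L ≡ 1) where

    V : ℕ
    V = sumL nonInd L

    length-L : length L ≡ suc V
    length-L = begin
      length L                              ≡⟨ length≡sumL L ⟩
      sumL (λ _ → 1) L                      ≡⟨ sumL-cong (λ p → sym (𝟙-¬ (origin? p))) L ⟩
      sumL (λ p → ind p + nonInd p) L       ≡⟨ sumL-+ ind nonInd L ⟩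
      sumL ind L + V                        ≡⟨ cong (_+ V) one-origin ⟩
      suc V                                 ∎
      where open ≡-Reasoning

    tuples-positive : ∀ n → All PositiveSample (tuples L n)
    tuples-positive zero = (λ ()) ∷ []
    tuples-positive (suc n) = All-⊗ cons-positive L-pos (tuples-positive n)
      where
      cons-positive : ∀ p (s : Fin n → Point d) → Positive p → PositiveSample s → PositiveSample (p ∷ᶠ s)
      cons-positive p s p-pos s-pos zero = p-pos
      cons-positive p s p-pos s-pos (suc i) = s-pos i

    skySum : ℕ → ℕ → ℕ
    skySum k n = sumL (skylineCount k) (tuples L n)

    originSum : ∀ n → suc V * sumL originCount (tuples L n) ≡ n * suc V ^ n
    originSum n = begin
      suc V * sumL originCount (tuples L n)       ≡⟨ cong (_* sumL originCount (tuples L n)) length-L ⟨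
      length L * sumL originCount (tuples L n)    ≡⟨ sum-tuples-Σᶠ ind L n ⟩
      n * (length L ^ n * sumL ind L)             ≡⟨ cong₂ (λ U c → n * (U ^ n * c)) length-L one-origin ⟩
      n * (suc V ^ n * 1)                         ≡⟨ cong (n *_) (*-identityʳ _) ⟩
      n * suc V ^ n                               ∎
      where open ≡-Reasoning

    noOriginSum : ∀ n → sumL noOrigin (tuples L n) ≡ V ^ n
    noOriginSum = sum-tuples-Πᶠ nonInd L

    skySum-lower : ∀ k n → n * suc V ^ n ≤ suc V * skySum k n
    skySum-lower k n = begin
      n * suc V ^ n                               ≡⟨ originSum n ⟨
      suc V * sumL originCount (tuples L n)
        ≤⟨ *-monoʳ-≤ (suc V) (sumL-mono (λ s s-pos → originCount≤skylineCount s-pos) (tuples-positive n)) ⟩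
      suc V * skySum k n                          ∎
      where open ≤-Reasoning

    skySum-upper : ∀ k n → 1 ≤ k → k ≤ d → suc V * skySum k n ≤ n * suc V ^ n + suc V * (n * V ^ n)
    skySum-upper k n 1≤k k≤d = begin
      suc V * skySum k n
        ≤⟨ *-monoʳ-≤ (suc V) (sumL-mono (λ s s-pos → skylineCount≤ s-pos 1≤k k≤d) (tuples-positive n)) ⟩
      suc V * sumL (λ s → originCount s + n * noOrigin s) (tuples L n)
        ≡⟨ cong (suc V *_) (trans (sumL-+ originCount (λ s → n * noOrigin s) (tuples L n))
                                  (cong (sumL originCount (tuples L n) +_) (sumL-*ˡ n noOrigin (tuples L n)))) ⟩
      suc V * (sumL originCount (tuples L n) + n * sumL noOrigin (tuples L n))
        ≡⟨ *-distribˡ-+ (suc V) (sumL originCount (tuples L n)) (n * sumL noOrigin (tuples L n)) ⟩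
      suc V * sumL originCount (tuples L n) + suc V * (n * sumL noOrigin (tuples L n))
        ≡⟨ cong₂ (λ a b → a + suc V * (n * b)) (originSum n) (noOriginSum n) ⟩
      n * suc V ^ n + suc V * (n * V ^ n)         ∎
      where open ≤-Reasoning

module Arithmetic where

  open import Data.Nat
  open import Data.Nat.Properties
  open import Data.Nat.Tactic.RingSolver using (solve-∀)
  open import Relation.Binary.PropositionalEquality

  -- Bernoulli's inequality (1 + 1/V)^n ≥ 1 + n/V, cleared of denominators.
  bernoulli : ∀ V n → V ^ n * (V + n) ≤ V * suc V ^ n
  bernoulli V zero = ≤-reflexive (trans (*-identityˡ (V + 0)) (trans (+-identityʳ V) (sym (*-identityʳ V))))
  bernoulli V (suc n) = begin
    V ^ suc n * (V + suc n)                   ≤⟨ m≤m+n _ (V ^ n * n) ⟩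
    V * V ^ n * (V + suc n) + V ^ n * n       ≡⟨ regroup (V ^ n) V n ⟩
    suc V * (V ^ n * (V + n))                 ≤⟨ *-monoʳ-≤ (suc V) (bernoulli V n) ⟩
    suc V * (V * suc V ^ n)                   ≡⟨ swap V (suc V ^ n) ⟩
    V * suc V ^ suc n                         ∎
    where
    open ≤-Reasoning
    regroup : ∀ P V n → V * P * (V + suc n) + P * n ≡ suc V * (P * (V + n))
    regroup = solve-∀
    swap : ∀ V Q → suc V * (V * Q) ≡ V * (suc V * Q)
    swap = solve-∀

  geometric-decay : ∀ V D n → suc V * D ≤ n → V ^ n * D < suc V ^ n
  geometric-decay V D n n-large = *-cancelˡ-< (suc V) _ _ (begin-strict
    suc V * (V ^ n * D)      ≡⟨ swap (V ^ n) V D ⟩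
    V ^ n * (suc V * D)      ≤⟨ *-monoʳ-≤ (V ^ n) n-large ⟩
    V ^ n * n                ≤⟨ *-monoʳ-≤ (V ^ n) (m≤n+m n V) ⟩
    V ^ n * (V + n)          ≤⟨ bernoulli V n ⟩
    V * suc V ^ n            <⟨ *-monoˡ-< (suc V ^ n) {{>-nonZero (m^n>0 (suc V) n)}} (n<1+n V) ⟩
    suc V * suc V ^ n        ∎)
    where
    open ≤-Reasoning
    swap : ∀ P V D → suc V * (P * D) ≡ P * (suc V * D)
    swap = solve-∀

  -- The strict upper bound of the sandwich, cleared of denominators: with U = V+1,
  -- U·a ≤ nT + U·n·Z and Z·D < T give a/(nT) < 1/U + 1/D.
  sandwich-upper : ∀ V m T a Z D → suc V * a ≤ suc m * T + suc V * (suc m * Z) → Z * D < T →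
    a * (suc V * D) < (D + suc V) * (T * suc m)
  sandwich-upper V m T a Z D upper ZD<T = begin-strict
    a * (U * D)                    ≡⟨ regroup₁ a U D ⟩
    (U * a) * D                    ≤⟨ *-monoˡ-≤ D upper ⟩
    (n * T + U * (n * Z)) * D      ≡⟨ regroup₂ n T U Z D ⟩
    n * T * D + U * n * (Z * D)    <⟨ +-monoʳ-< (n * T * D) (*-monoʳ-< (U * n) ZD<T) ⟩
    n * T * D + U * n * T          ≡⟨ regroup₃ n T D U ⟩
    (D + U) * (T * n)              ∎
    where
    open ≤-Reasoning
    U n : ℕ
    U = suc V
    n = suc m
    regroup₁ : ∀ a U D → a * (U * D) ≡ (U * a) * D
    regroup₁ = solve-∀
    regroup₂ : ∀ n T U Z D → (n * T + U * (n * Z)) * D ≡ n * T * D + U * n * (Z * D)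
    regroup₂ = solve-∀
    regroup₃ : ∀ n T D U → n * T * D + U * n * T ≡ (D + U) * (T * n)
    regroup₃ = solve-∀

module Limit where

  open import Defs using (frac)
  open Arithmetic
  open import Data.Nat as ℕ using (ℕ; suc; z≤n; s≤s)
  import Data.Nat.Properties as ℕ
  open import Data.Integer as ℤ using (+_; +≤+; +<+; +0; +[1+_]; -[1+_])
  import Data.Integer.Properties as ℤ
  open import Data.Rational using (ℚ; mkℚ; 0ℚ; _≤_; _<_; _+_; _-_; _*_; -_; ∣_∣; toℚᵘ; *<*)
  open import Data.Rational.Properties
  open import Data.Rational.Unnormalised as ℚᵘ using (mkℚᵘ; *≤*; *≡*) renaming (*<* to *<*ᵘ)
  import Data.Rational.Unnormalised.Properties as ℚᵘ
  open import Data.Product using (∃; _,_)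
  open import Relation.Binary.PropositionalEquality

  frac-ᵘ : ∀ a b → toℚᵘ (frac a (suc b)) ℚᵘ.≃ mkℚᵘ (+ a) b
  frac-ᵘ a b = toℚᵘ-fromℚᵘ (mkℚᵘ (+ a) b)

  frac-≤ : ∀ a b c d → a ℕ.* suc d ℕ.≤ c ℕ.* suc b → frac a (suc b) ≤ frac c (suc d)
  frac-≤ a b c d ad≤cb = toℚᵘ-cancel-≤
    (ℚᵘ.≤-respˡ-≃ (ℚᵘ.≃-sym (frac-ᵘ a b)) (ℚᵘ.≤-respʳ-≃ (ℚᵘ.≃-sym (frac-ᵘ c d))
    (*≤* (subst₂ ℤ._≤_ (ℤ.pos-* a (suc d)) (ℤ.pos-* c (suc b)) (+≤+ ad≤cb)))))

  frac-< : ∀ a b c d → a ℕ.* suc d ℕ.< c ℕ.* suc b → frac a (suc b) < frac c (suc d)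
  frac-< a b c d ad<cb = toℚᵘ-cancel-<
    (ℚᵘ.<-respˡ-≃ (ℚᵘ.≃-sym (frac-ᵘ a b)) (ℚᵘ.<-respʳ-≃ (ℚᵘ.≃-sym (frac-ᵘ c d))
    (*<*ᵘ (subst₂ ℤ._<_ (ℤ.pos-* a (suc d)) (ℤ.pos-* c (suc b)) (+<+ ad<cb)))))

  frac-* : ∀ a b c d → frac a (suc b) * frac c (suc d) ≡ frac (a ℕ.* c) (suc b ℕ.* suc d)
  frac-* a b c d = toℚᵘ-injective (ℚᵘ.≃-trans (toℚᵘ-homo-* (frac a (suc b)) (frac c (suc d)))
    (ℚᵘ.≃-trans (ℚᵘ.*-cong (frac-ᵘ a b) (frac-ᵘ c d))
    (ℚᵘ.≃-trans (*≡* (cong (ℤ._* (+ suc (d ℕ.+ b ℕ.* suc d))) (sym (ℤ.pos-* a c))))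
      (ℚᵘ.≃-sym (frac-ᵘ (a ℕ.* c) (d ℕ.+ b ℕ.* suc d))))))

  frac-+ : ∀ a b c d → frac a (suc b) + frac c (suc d) ≡ frac (a ℕ.* suc d ℕ.+ c ℕ.* suc b) (suc b ℕ.* suc d)
  frac-+ a b c d = toℚᵘ-injective (ℚᵘ.≃-trans (toℚᵘ-homo-+ (frac a (suc b)) (frac c (suc d)))
    (ℚᵘ.≃-trans (ℚᵘ.+-cong (frac-ᵘ a b) (frac-ᵘ c d))
    (ℚᵘ.≃-trans (*≡* (cong (ℤ._* (+ suc (d ℕ.+ b ℕ.* suc d))) (sym numerator)))
      (ℚᵘ.≃-sym (frac-ᵘ (a ℕ.* suc d ℕ.+ c ℕ.* suc b) (d ℕ.+ b ℕ.* suc d))))))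
    where
    numerator : + (a ℕ.* suc d ℕ.+ c ℕ.* suc b) ≡ + a ℤ.* + suc d ℤ.+ + c ℤ.* + suc b
    numerator = trans (ℤ.pos-+ (a ℕ.* suc d) (c ℕ.* suc b)) (cong₂ ℤ._+_ (ℤ.pos-* a (suc d)) (ℤ.pos-* c (suc b)))

  unit-fraction-below : ∀ ε → 0ℚ < ε → ∃ λ D → frac 1 (suc D) ≤ ε
  unit-fraction-below (mkℚ +0 _ _) (*<* (+<+ ()))
  unit-fraction-below (mkℚ -[1+ _ ] _ _) (*<* ())
  unit-fraction-below ε@(mkℚ +[1+ a ] b _) _ =
    b , subst (frac 1 (suc b) ≤_) (↥p/↧p≡p ε)
              (frac-≤ 1 b (suc a) b (ℕ.*-monoˡ-≤ (suc b) {1} {suc a} (s≤s z≤n)))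

  squeeze : ∀ {r x e : ℚ} → r ≤ x → x < r + e → ∣ x - r ∣ < e
  squeeze {r} {x} {e} r≤x x<r+e = subst (_< e) (sym (0≤p⇒∣p∣≡p 0≤x-r)) x-r<e
    where
    cancel : ∀ p → p + r - r ≡ p
    cancel p = trans (+-assoc p r (- r)) (trans (cong (λ q → p + q) (+-inverseʳ r)) (+-identityʳ p))
    0≤x-r : 0ℚ ≤ x - r
    0≤x-r = subst (_≤ x - r) (+-inverseʳ r) (+-monoˡ-≤ (- r) r≤x)
    x-r<e : x - r < e
    x-r<e = subst (x - r <_) (cancel e) (+-monoˡ-< (- r) (subst (x <_) (+-comm r e) x<r+e))

  -- If n·(V+1)^n ≤ (V+1)·a_n ≤ n·(V+1)^n + (V+1)·n·V^n for all n, then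
  -- a_n / ((V+1)^n · n) → 1/(V+1): the excess is at most (V/(V+1))^n, which decays geometrically.
  convergence : ∀ V (a : ℕ → ℕ) →
    (∀ n → n ℕ.* suc V ℕ.^ n ℕ.≤ suc V ℕ.* a n) →
    (∀ n → suc V ℕ.* a n ℕ.≤ n ℕ.* suc V ℕ.^ n ℕ.+ suc V ℕ.* (n ℕ.* V ℕ.^ n)) →
    ∀ ε → 0ℚ < ε → ∃ λ N → ∀ n → N ℕ.≤ n →
      ∣ frac (a n) (suc V ℕ.^ n) * frac 1 n - frac 1 (suc V) ∣ < ε
  convergence V a lower upper ε 0<ε with unit-fraction-below ε 0<ε
  ... | D , 1/D≤ε = suc V ℕ.* suc D , close
    where
    -- Here n ≥ N ≥ 1, and (V+1)^n ≥ 1 by the decay bound; the remaining cases are absurd.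
    close : ∀ n → suc V ℕ.* suc D ℕ.≤ n → ∣ frac (a n) (suc V ℕ.^ n) * frac 1 n - frac 1 (suc V) ∣ < ε
    close (suc m) n-large
      with suc V ℕ.^ suc m | lower (suc m) | upper (suc m) | geometric-decay V (suc D) (suc m) n-large
    ... | suc t | lo | hi | decay = squeeze r≤x x<r+ε
      where
      A : ℕ
      A = a (suc m)
      -- With T = t + 1 = (V+1)^n, the two halves of the sandwich with denominators cleared.
      lo′ : 1 ℕ.* (suc t ℕ.* suc m) ℕ.≤ A ℕ.* suc V
      lo′ = subst₂ ℕ._≤_ (trans (ℕ.*-comm (suc m) (suc t)) (sym (ℕ.*-identityˡ _))) (ℕ.*-comm (suc V) A) lo
      hi′ : A ℕ.* (suc V ℕ.* suc D) ℕ.< (suc D ℕ.+ suc V) ℕ.* (suc t ℕ.* suc m)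
      hi′ = sandwich-upper V m (suc t) A (V ℕ.^ suc m) (suc D) hi decay
      x≡ : frac A (suc t) * frac 1 (suc m) ≡ frac A (suc t ℕ.* suc m)
      x≡ = trans (frac-* A t 1 m) (cong (λ c → frac c (suc t ℕ.* suc m)) (ℕ.*-identityʳ A))
      r+1/D≡ : frac 1 (suc V) + frac 1 (suc D) ≡ frac (suc D ℕ.+ suc V) (suc V ℕ.* suc D)
      r+1/D≡ = trans (frac-+ 1 V 1 D)
        (cong₂ (λ p q → frac (p ℕ.+ q) (suc V ℕ.* suc D)) (ℕ.*-identityˡ (suc D)) (ℕ.*-identityˡ (suc V)))
      r≤x : frac 1 (suc V) ≤ frac A (suc t) * frac 1 (suc m)
      r≤x = subst (frac 1 (suc V) ≤_) (sym x≡) (frac-≤ 1 V A _ lo′)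
      x<r+ε : frac A (suc t) * frac 1 (suc m) < frac 1 (suc V) + ε
      x<r+ε = begin-strict
        frac A (suc t) * frac 1 (suc m)                 ≡⟨ x≡ ⟩
        frac A (suc t ℕ.* suc m)                        <⟨ frac-< A _ (suc D ℕ.+ suc V) _ hi′ ⟩
        frac (suc D ℕ.+ suc V) (suc V ℕ.* suc D)        ≡⟨ r+1/D≡ ⟨
        frac 1 (suc V) + frac 1 (suc D)                 ≤⟨ +-monoʳ-≤ (frac 1 (suc V)) 1/D≤ε ⟩
        frac 1 (suc V) + ε                              ∎
        where open ≤-Reasoning

open import Defs
open import Data.Nat using (ℕ; _≤_)
open import Data.Fin using (Fin)
open import Data.Product using (∃)
open import Data.Rational using (ℚ; 0ℚ; _<_; _-_; _*_; ∣_∣)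
open import Data.Nat using (_^_; z≤n; s≤s)
open import Data.Nat.Properties using (≤-trans)
open import Data.Product using (_,_)
open import Data.List using (List)
open import Relation.Binary.PropositionalEquality using (sym; trans; cong; subst₂)

-- The expected k-skyline size divided by n is a_n/((V+1)^n n) with a_n the total skyline
-- count over the grid's sample space; the grid satisfies the hypotheses of SampleSpace,
-- whose bounds feed Limit.convergence.
theorem4 : (d : ℕ) → 2 ≤ d → (u : Fin d → ℕ) → (∀ j → 2 ≤ u j) →
    (k : ℕ) → 1 ≤ k → k ≤ d →
    (ε : ℚ) → 0ℚ < ε → ∃ λ N → ∀ n → N ≤ n →
    ∣ expectedSkyline d u k n * frac 1 n - frac 1 (prodF d u) ∣ < ε
theorem4 d _ u u≥2 k 1≤k k≤d ε 0<ε =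
  let N , converges = Limit.convergence V (skySum k) (skySum-lower k) (λ n → skySum-upper k n 1≤k k≤d) ε 0<ε in
  N , λ n N≤n → subst₂ (λ T U → ∣ frac (skySum k n) T * frac 1 n - frac 1 U ∣ < ε)
    (sym (trans (Sums.tuples-length L n) (cong (_^ n) length-L)))
    (sym (trans (sym (Grid.allPoints-length d u)) length-L))
    (converges n N≤n)
  where
  L : List (Point d)
  L = allPoints d u
  open Totals.SampleSpace L (Grid.allPoints-positive d u)
         (Grid.allPoints-one-origin d u (λ j → ≤-trans (s≤s z≤n) (u≥2 j)))
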